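{- Let $P : A\to\mathsf{Type}$, let $X,Y$ be types, $f : X\to \mathrm{Tree}_P Y$, $t : \mathrm{Tree}_P X$ equifoliate, and $y : Y$. Then $y\in \mathsf{bind}\,f\,t$ if and only if $\forall x{:}X.\; x\in t\Rightarrow y\in f\,x$.
   Context: We work in the Calculus of Inductive Constructions with an impredicative universe $\mathsf{Prop}$ of proof-irrelevant propositions, function extensionality, propositional extensionality, uniqueness of proofs of propositions, and definite description. For $P : A\to\mathsf{Type}$, $\mathcal{O}_P : \mathsf{Prop}\to\mathsf{Prop}$ is defined at $s$ as the inductive proposition with constructors $\mathsf{prf} : s\to\mathcal{O}_P\,s$ and $\mathsf{ask}:\prod_{a:A}(P\,a\to\mathcal{O}_P\,s)\to\mathcal{O}_P\,s$. $\mathrm{Tree}_P X$ is the inductive type with constructors $\mathsf{leaf} : X\to\mathrm{Tree}_P X$ and $\mathsf{node} : \prod_{a:A}(P\,a\to\mathrm{Tree}_P X)\to\mathrm{Tree}_P X$. $\mathsf{bind}\,f : \mathrm{Tree}_P X\to\mathrm{Tree}_P Y$ is defined by $\mathsf{bind}\,f\,(\mathsf{leaf}\,x) = f\,x$ and $\mathsf{bind}\,f\,(\mathsf{node}\,a\,\kappa)=\mathsf{node}\,a\,(\lambda u.\,\mathsf{bind}\,f\,(\kappa\,u))$. Membership $x\in t$ is defined inductively: $x\in\mathsf{leaf}\,y$ iff $\mathcal{O}_P(x=y)$; $x\in\mathsf{node}\,a\,\kappa$ iff $\forall u{:}P\,a.\;x\in\kappa\,u$. The predicate $\mathrm{equi}:\mathrm{Tree}_P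 X\to\mathsf{Prop}$ is defined inductively: $\mathrm{equi}(\mathsf{leaf}\,x)$ for all $x$; $\mathrm{equi}(\mathsf{node}\,a\,\kappa)$ when $\forall u{:}P\,a.\,\mathrm{equi}(\kappa\,u)$ and $\forall x{:}X.\,\forall u,v{:}P\,a.\; x\in\kappa\,u\Rightarrow x\in\kappa\,v$. A tree is equifoliate if it satisfies $\mathrm{equi}$. -}

module Defs where

open import Level using (Level; _⊔_)
open import Relation.Binary.PropositionalEquality using (_≡_)

-- The P-oracle modality 𝒪_P (here on types; the paper's propositions)
data 𝒪 {a p s} {A : Set a} (P : A → Set p) (S : Set s) : Set (a ⊔ p ⊔ s) where
  prf : S → 𝒪 P S
  ask : (x : A) → (P x → 𝒪 P S) → 𝒪 P S

data Tree {a p x} {A : Set a} (P : A → Set p) (X : Set x) : Set (a ⊔ p ⊔ x) where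
  leaf : X → Tree P X
  node : (x : A) → (P x → Tree P X) → Tree P X

module _ {a p} {A : Set a} {P : A → Set p} where

  bind : ∀ {x y} {X : Set x} {Y : Set y} → (X → Tree P Y) → Tree P X → Tree P Y
  bind f (leaf x)   = f x
  bind f (node a κ) = node a (λ u → bind f (κ u))

  data _∈_ {x} {X : Set x} (z : X) : Tree P X → Set (a ⊔ p ⊔ x) where
    ∈leaf : ∀ {y} → 𝒪 P (z ≡ y) → z ∈ leaf y
    ∈node : ∀ {b κ} → (∀ u → z ∈ κ u) → z ∈ node b κ

  data equi {x} {X : Set x} : Tree P X → Set (a ⊔ p ⊔ x) where
    equi-leaf : ∀ y → equi (leaf y)
    equi-node : ∀ {b κ} → (∀ u → equi (κ u))
              → (∀ (z : X) (u v : P b) → z ∈ κ u → z ∈ κ v)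
              → equi (node b κ)

-- Membership is defined through 𝒪 at the leaves and by a universal quantifier
-- at the nodes, so it is 𝒪-stable: 𝒪 (w ∈ s) implies w ∈ s. Hence from
-- w ∈ bind f t and z ∈ t one may ask the questions along the path of t that z
-- follows and conclude w ∈ f z. Conversely, w ∈ bind f (node b κ) requires
-- w ∈ bind f (κ u) for each answer u, and the induction hypothesis on κ u needs
-- every z ∈ κ u to lie in the whole node, which is exactly what
-- equifoliateness provides.
module Submission where

open import Defs
open import Data.Product using (_×_; _,_)
open import Relation.Binary.PropositionalEquality using (_≡_; refl)

module _ {a p} {A : Set a} {P : A → Set p} where

  𝒪-map : ∀ {s t} {S : Set s} {T : Set t} → (S → T) → 𝒪 P S → 𝒪 P T
  𝒪-map g (prf s)   = prf (g s)
  𝒪-map g (ask b k) = ask b (λ u → 𝒪-map g (k u))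

  𝒪-join : ∀ {s} {S : Set s} → 𝒪 P (𝒪 P S) → 𝒪 P S
  𝒪-join (prf o)   = o
  𝒪-join (ask b k) = ask b (λ u → 𝒪-join (k u))

  module _ {x} {X : Set x} where

    ∈-leaf⁻ : ∀ {w y : X} → _∈_ {P = P} w (leaf y) → 𝒪 P (w ≡ y)
    ∈-leaf⁻ (∈leaf o) = o

    ∈-node⁻ : ∀ {w : X} {b κ} → _∈_ {P = P} w (node b κ) → ∀ u → w ∈ κ u
    ∈-node⁻ (∈node h) = h

    ∈-𝒪-stable : ∀ {w : X} (s : Tree P X) → 𝒪 P (w ∈ s) → w ∈ s
    ∈-𝒪-stable (leaf y)   o = ∈leaf (𝒪-join (𝒪-map ∈-leaf⁻ o))
    ∈-𝒪-stable (node b κ) o = ∈node (λ u → ∈-𝒪-stable (κ u) (𝒪-map (λ m → ∈-node⁻ m u) o))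

    equi-∈-node⁺ : ∀ {z : X} {b κ} → equi {P = P} (node b κ) → ∀ u → z ∈ κ u → z ∈ node b κ
    equi-∈-node⁺ (equi-node _ same) u z∈κu = ∈node (λ v → same _ u v z∈κu)

  module _ {x y} {X : Set x} {Y : Set y} (f : X → Tree P Y) where

    ∈-bind⁻ : ∀ (t : Tree P X) {w : Y} → w ∈ bind f t → ∀ z → z ∈ t → w ∈ f z
    ∈-bind⁻ (leaf y)   w∈fy        z (∈leaf z≡y) =
      ∈-𝒪-stable (f z) (𝒪-map (λ { refl → w∈fy }) z≡y)
    ∈-bind⁻ (node b κ) (∈node w∈κ) z (∈node z∈κ) =
      ∈-𝒪-stable (f z) (ask b (λ u → prf (∈-bind⁻ (κ u) (w∈κ u) z (z∈κ u))))

    ∈-bind⁺ : ∀ (t : Tree P X) → equi t → ∀ {w : Y} → (∀ z → z ∈ t → w ∈ f z) → w ∈ bind f t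
    ∈-bind⁺ (leaf y)   _                       w∈f = w∈f y (∈leaf (prf refl))
    ∈-bind⁺ (node b κ) e@(equi-node equiκ _) w∈f =
      ∈node (λ u → ∈-bind⁺ (κ u) (equiκ u) (λ z z∈κu → w∈f z (equi-∈-node⁺ e u z∈κu)))

lemma36 : ∀ {a p x y} {A : Set a} (P : A → Set p) {X : Set x} {Y : Set y}
          (f : X → Tree P Y) (t : Tree P X) → equi t → (w : Y) →
          ((w ∈ bind f t) → (∀ (z : X) → z ∈ t → w ∈ f z))
          × ((∀ (z : X) → z ∈ t → w ∈ f z) → (w ∈ bind f t))
lemma36 P f t equi-t w = ∈-bind⁻ f t , ∈-bind⁺ f t equi-t
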